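{- Let $G=(V,E)$ be a connected graph on $n\geq 4$ vertices with $V=\{p_1,\ldots,p_{n-1},q\}$, such that $p_1-p_2-\cdots-p_{n-1}$ is a path in $G$. If $\psi_{n-1}(G)=2$ and $\psi_n(G)=0$, then $2\leq d(q)\leq \left\lceil \frac{n-3}{2}\right\rceil$.
   Context: All graphs are finite and simple; $d(v)$ denotes the degree of a vertex $v$. For a graph $G=(V,E)$ and a positive integer $k$, a $k$-path vertex cover of $G$ is a set $S\subseteq V$ such that every path on $k$ vertices in $G$ contains at least one vertex of $S$, and $\psi_k(G)$ is the minimum cardinality of such a set. -}

module Defs where

open import Data.Nat using (ℕ; zero; suc; _+_; _≤_)
open import Data.Bool using (Bool; true; false; if_then_else_)
open import Data.Fin using (Fin; toℕ)
open import Data.Fin.Subset using (Subset; _∈_; ∣_∣)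
open import Data.List using (List; map; allFin)
open import Data.Nat.ListAction using (sum)
open import Data.Product using (Σ; _×_; ∃)
open import Relation.Binary.PropositionalEquality using (_≡_; _≢_)
open import Function.Definitions using (Injective)

record Graph (n : ℕ) : Set where
  field
    adj   : Fin n → Fin n → Bool
    sym   : ∀ u v → adj u v ≡ adj v u
    irrefl : ∀ v → adj v v ≡ false
open Graph public

degree : ∀ {n} → Graph n → Fin n → ℕ
degree {n} G v = sum (map (λ u → if adj G v u then 1 else 0) (allFin n))

data Reach {n : ℕ} (G : Graph n) : Fin n → Fin n → Set where
  here : ∀ {v} → Reach G v v
  step : ∀ {u v w} → adj G u v ≡ true → Reach G v w → Reach G u w

Connected : ∀ {n} → Graph n → Set
Connected {n} G = ∀ (u v : Fin n) → Reach G u v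

IsPath : ∀ {n} → Graph n → (k : ℕ) → (Fin k → Fin n) → Set
IsPath G k f =
  Injective _≡_ _≡_ f ×
  (∀ (i j : Fin k) → toℕ j ≡ suc (toℕ i) → adj G (f i) (f j) ≡ true)

IsKPathVertexCover : ∀ {n} → Graph n → ℕ → Subset n → Set
IsKPathVertexCover {n} G k S =
  ∀ (f : Fin k → Fin n) → IsPath G k f → Σ (Fin k) (λ i → f i ∈ S)

ψ-is : ∀ {n} → ℕ → Graph n → ℕ → Set
ψ-is {n} k G m =
  Σ (Subset n) (λ S → IsKPathVertexCover G k S × ∣ S ∣ ≡ m) ×
  (∀ (S : Subset n) → IsKPathVertexCover G k S → m ≤ ∣ S ∣)

module Submission where

-- Proof idea.  Write m = n - 1, so p₀ … p_{m-1} lists every vertex except q.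
--
-- Upper bound.  Since ψ_n(G) = 0, G has no path on n vertices.  Hence q can
-- be inserted at no position of the path p: q is not adjacent to p₀, not to
-- p_{m-1}, and not to two consecutive vertices p_i, p_{i+1}.  Marking the
-- neighbours of q along p therefore gives a Boolean sequence of length m
-- without an admissible insertion point ("gap"), and such a sequence has at
-- most ⌊(m-1)/2⌋ = ⌈(n-3)/2⌉ marks.  As p together with q enumerates all
-- vertices, d(q) is exactly the number of marks.
--
-- Lower bound.  By connectivity q has a neighbour u.  If d(q) < 2, u is its
-- only neighbour, and {u} meets every path on n - 1 vertices: such a path
-- either passes through q, and then through q's unique neighbour u, or
-- avoids q, and then visits all other vertices.  This contradicts
-- ψ_{n-1}(G) = 2.

open import Defs
open import Data.Nat using (ℕ; zero; suc; _+_; _≤_; _∸_; ⌈_/2⌉; ⌊_/2⌋; z≤n; s≤s; _≤?_)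
open import Data.Nat.Properties
  using (+-0-commutativeMonoid; ≤-trans; ≤-reflexive; n≤1+n; m≤n+m; ⌊n/2⌋-mono; 1+n≰n; suc-injective; module ≤-Reasoning)
open import Data.Nat.ListAction using () renaming (sum to listSum)
open import Algebra.Properties.CommutativeMonoid.Sum +-0-commutativeMonoid using (sum; sum-permute)
open import Data.Bool using (Bool; true; false; if_then_else_)
open import Data.Bool.Properties using (¬-not) renaming (_≟_ to _≟ᵇ_)
open import Data.Fin using (Fin; zero; suc; toℕ; punchOut; inject₁)
open import Data.Fin.Properties using (any?; punchOut-injective; injective⇒≤; toℕ-inject₁)
  renaming (_≟_ to _≟ᶠ_; suc-injective to suc-injectiveᶠ)
open import Data.Fin.Permutation using (permutation)
open import Data.Fin.Subset using (⁅_⁆; _∈_)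
open import Data.Fin.Subset.Properties using (x∈⁅x⁆; ∣⁅x⁆∣≡1; x∈p⇒∣p-x∣<∣p∣)
open import Data.Vec.Functional using (Vector; _∷_; tail; insertAt)
open import Data.List using (map; tabulate)
open import Data.Product using (_×_; _,_; proj₁; proj₂; ∃)
open import Function using (_∘_)
open import Relation.Nullary using (¬_; yes; no; contradiction)
open import Relation.Binary.PropositionalEquality
  using (_≡_; _≢_; _≗_; refl; trans; cong; subst; subst₂; module ≡-Reasoning)
  renaming (sym to ≡-sym)
open import Function.Definitions using (Injective)

count : ∀ {m} → Vector Bool m → ℕ
count b = sum (λ i → if b i then 1 else 0)

count-pos : ∀ {m} (b : Vector Bool m) i → b i ≡ true → 1 ≤ count b
count-pos b zero    bᵢ rewrite bᵢ = s≤s z≤n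
count-pos b (suc i) bᵢ = ≤-trans (count-pos (tail b) i bᵢ) (m≤n+m _ _)

count-two : ∀ {m} (b : Vector Bool m) i j → i ≢ j → b i ≡ true → b j ≡ true → 2 ≤ count b
count-two b zero    zero    i≢j _  _  = contradiction refl i≢j
count-two b zero    (suc j) _   bᵢ bⱼ rewrite bᵢ = s≤s (count-pos (tail b) j bⱼ)
count-two b (suc i) zero    _   bᵢ bⱼ rewrite bⱼ = s≤s (count-pos (tail b) i bᵢ)
count-two b (suc i) (suc j) i≢j bᵢ bⱼ =
  ≤-trans (count-two (tail b) i j (i≢j ∘ cong suc) bᵢ bⱼ) (m≤n+m _ _)

-- Gap b t: position t (between entries t-1 and t) of the sequence b₀ … b_m
-- admits inserting a new element that is adjacent to the marked entries,
-- i.e. its would-be predecessor and successor, where they exist, are marked.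
Gap : ∀ {m} → Vector Bool (suc m) → Fin (suc (suc m)) → Set
Gap         b zero          = b zero ≡ true
Gap {zero}  b (suc zero)    = b zero ≡ true
Gap {suc m} b (suc zero)    = b zero ≡ true × b (suc zero) ≡ true
Gap {suc m} b (suc (suc t)) = Gap (tail b) (suc t)

count-unmarkedHead : ∀ {m} (b : Vector Bool (suc m)) → b zero ≡ false → count b ≡ count (tail b)
count-unmarkedHead b b₀ = cong (λ c → (if c then 1 else 0) + count (tail b)) b₀

count-markedHead : ∀ {m} (b : Vector Bool (suc m)) → b zero ≡ true → count b ≡ suc (count (tail b))
count-markedHead b b₀ = cong (λ c → (if c then 1 else 0) + count (tail b)) b₀

-- Without inner or final gaps, marks are separated by unmarked entries and
-- the last entry is unmarked.  Starting from an unmarked entry b₀, either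
-- b₁ is unmarked too (drop b₀), or b₁ is marked and then b₂ exists and is
-- unmarked (drop b₀ b₁, paying one mark for two positions).
unmarkedStart-count : ∀ m (b : Vector Bool (suc m)) → b zero ≡ false →
  (∀ t → ¬ Gap b (suc t)) → count b ≤ ⌊ m /2⌋
markedSecond-count : ∀ m (b : Vector Bool (suc (suc m))) → b zero ≡ false → b (suc zero) ≡ true →
  (∀ t → ¬ Gap b (suc t)) → count b ≤ ⌊ suc m /2⌋

unmarkedStart-count zero    b b₀ _     = ≤-reflexive (count-unmarkedHead b b₀)
unmarkedStart-count (suc m) b b₀ noGap with b (suc zero) ≟ᵇ false
... | no  b₁≢false = markedSecond-count m b b₀ (¬-not b₁≢false) noGap
... | yes b₁ = begin
  count b          ≡⟨ count-unmarkedHead b b₀ ⟩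
  count (tail b)   ≤⟨ unmarkedStart-count m (tail b) b₁ (noGap ∘ suc) ⟩
  ⌊ m /2⌋          ≤⟨ ⌊n/2⌋-mono (n≤1+n m) ⟩
  ⌊ suc m /2⌋      ∎
  where open ≤-Reasoning

markedSecond-count zero    b b₀ b₁ noGap = contradiction b₁ (noGap (suc zero))
markedSecond-count (suc m) b b₀ b₁ noGap with b (suc (suc zero)) ≟ᵇ false
... | no  b₂≢false = contradiction (b₁ , ¬-not b₂≢false) (noGap (suc zero))
... | yes b₂ = begin
  count b                       ≡⟨ count-unmarkedHead b b₀ ⟩
  count (tail b)                ≡⟨ count-markedHead (tail b) b₁ ⟩
  suc (count (tail (tail b)))   ≤⟨ s≤s (unmarkedStart-count m (tail (tail b)) b₂ (λ t → noGap (suc (suc t)))) ⟩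
  suc ⌊ m /2⌋                   ∎
  where open ≤-Reasoning

gapFree-count : ∀ {m} (b : Vector Bool (suc m)) → (∀ t → ¬ Gap b t) → count b ≤ ⌊ m /2⌋
gapFree-count {m} b noGap with b zero ≟ᵇ false
... | yes b₀       = unmarkedStart-count m b b₀ (noGap ∘ suc)
... | no  b₀≢false = contradiction (¬-not b₀≢false) (noGap zero)

∷-injective : ∀ {A : Set} {m} {x : A} {f : Vector A m} →
  Injective _≡_ _≡_ f → (∀ i → f i ≢ x) → Injective _≡_ _≡_ (x ∷ f)
∷-injective f-inj fresh {zero}  {zero}  _ = refl
∷-injective f-inj fresh {zero}  {suc j} e = contradiction (≡-sym e) (fresh j)
∷-injective f-inj fresh {suc i} {zero}  e = contradiction e (fresh i)
∷-injective f-inj fresh {suc i} {suc j} e = cong suc (f-inj e)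

-- Finite pigeonhole: an injective self-map of Fin n is surjective.  A missed
-- point y would let us squeeze Fin n injectively into Fin (n - 1).
injective⇒surjective : ∀ {n} (f : Fin n → Fin n) → Injective _≡_ _≡_ f →
  ∀ y → ∃ λ x → f x ≡ y
injective⇒surjective {suc n} f f-inj y with any? (λ x → f x ≟ᶠ y)
... | yes hit  = hit
... | no  miss = contradiction (injective⇒≤ squeeze-injective) 1+n≰n
  where
  y≢f : ∀ x → y ≢ f x
  y≢f x y≡fx = miss (x , ≡-sym y≡fx)

  squeeze : Fin (suc n) → Fin n
  squeeze x = punchOut (y≢f x)

  squeeze-injective : Injective _≡_ _≡_ squeeze
  squeeze-injective e = f-inj (punchOut-injective (y≢f _) (y≢f _) e)

-- Counting is invariant under reindexing by an injective self-map, which is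
-- a permutation by the pigeonhole principle.
count-reindex : ∀ {n} (b : Vector Bool n) (σ : Fin n → Fin n) → Injective _≡_ _≡_ σ →
  count b ≡ count (b ∘ σ)
count-reindex b σ σ-inj =
  sum-permute (λ i → if b i then 1 else 0)
    (permutation σ σ⁻¹ (proj₂ ∘ onto) (λ x → σ-inj (proj₂ (onto (σ x)))))
  where
  onto : ∀ y → ∃ λ x → σ x ≡ y
  onto = injective⇒surjective σ σ-inj

  σ⁻¹ : Fin _ → Fin _
  σ⁻¹ = proj₁ ∘ onto

listSum-map-tabulate : ∀ {A : Set} {n} (g : A → ℕ) (f : Fin n → A) →
  listSum (map g (tabulate f)) ≡ sum (g ∘ f)
listSum-map-tabulate {n = zero}  g f = refl
listSum-map-tabulate {n = suc n} g f = cong (g (f zero) +_) (listSum-map-tabulate g (f ∘ suc))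

degree≡count : ∀ {n} (G : Graph n) v → degree G v ≡ count (adj G v)
degree≡count G v = listSum-map-tabulate (λ u → if adj G v u then 1 else 0) (λ u → u)

-- If p lists every vertex except q exactly once, d(q) is the number of
-- neighbours of q along p: reindex by the bijection q ∷ p and drop the
-- (zero) loop term.
degree-along : ∀ {m} (G : Graph (suc m)) q (p : Fin m → Fin (suc m)) →
  Injective _≡_ _≡_ p → (∀ i → p i ≢ q) → degree G q ≡ count (adj G q ∘ p)
degree-along G q p p-inj p≢q = begin
  degree G q                    ≡⟨ degree≡count G q ⟩
  count (adj G q)               ≡⟨ count-reindex (adj G q) (q ∷ p) (∷-injective p-inj p≢q) ⟩
  count (adj G q ∘ (q ∷ p))     ≡⟨ cong (λ c → (if c then 1 else 0) + count (adj G q ∘ p)) (irrefl G q) ⟩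
  count (adj G q ∘ p)           ∎
  where open ≡-Reasoning

module _ {n} (G : Graph n) where

  Walk : (k : ℕ) → (Fin k → Fin n) → Set
  Walk k f = ∀ (i j : Fin k) → toℕ j ≡ suc (toℕ i) → adj G (f i) (f j) ≡ true

  IsPath-≗ : ∀ {k} {f g : Fin k → Fin n} → f ≗ g → IsPath G k f → IsPath G k g
  IsPath-≗ f≗g (f-inj , f-walk) =
      (λ {i} {j} e → f-inj (trans (f≗g i) (trans e (≡-sym (f≗g j)))))
    , λ i j e → subst₂ (λ a b → adj G a b ≡ true) (f≗g i) (f≗g j) (f-walk i j e)

  singleton-path : (f : Fin 1 → Fin n) → IsPath G 1 f
  singleton-path f = (λ { {zero} {zero} _ → refl }) , λ { zero zero () }

  tail-path : ∀ {k} {f : Fin (suc k) → Fin n} → IsPath G (suc k) f → IsPath G k (tail f)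
  tail-path (f-inj , f-walk) = suc-injectiveᶠ ∘ f-inj , λ i j e → f-walk (suc i) (suc j) (cong suc e)

  ∷-path : ∀ {k} {x} {f : Fin (suc k) → Fin n} → IsPath G (suc k) f →
    (∀ i → f i ≢ x) → adj G x (f zero) ≡ true → IsPath G (suc (suc k)) (x ∷ f)
  ∷-path {x = x} {f} (f-inj , f-walk) fresh x~f₀ = ∷-injective f-inj fresh , walk
    where
    walk : Walk (suc (suc _)) (x ∷ f)
    walk zero    (suc zero)    _ = x~f₀
    walk (suc i) (suc j)       e = f-walk i j (suc-injective e)
    walk zero    zero          ()
    walk zero    (suc (suc j)) ()
    walk (suc i) zero          ()

  -- ψ_k(G) = 0 means that G has no path on k vertices: it would have to
  -- meet the empty cover.
  ψ≡0⇒noPath : ∀ {k} → ψ-is k G 0 → ∀ f → ¬ IsPath G k f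
  ψ≡0⇒noPath ((S , cover , ∣S∣≡0) , _) f path with cover f path
  ... | i , fᵢ∈S = contradiction
          (≤-trans (≤-trans (s≤s z≤n) (x∈p⇒∣p-x∣<∣p∣ fᵢ∈S)) (≤-reflexive ∣S∣≡0)) (λ ())

  path-neighbour : ∀ {k} {f : Fin (suc (suc k)) → Fin n} → IsPath G (suc (suc k)) f →
    ∀ j → ∃ λ j′ → adj G (f j) (f j′) ≡ true
  path-neighbour (_ , f-walk) zero    = suc zero , f-walk zero (suc zero) refl
  path-neighbour {f = f} (_ , f-walk) (suc j) = inject₁ j ,
    trans (Graph.sym G (f (suc j)) (f (inject₁ j)))
          (f-walk (inject₁ j) (suc j) (cong suc (≡-sym (toℕ-inject₁ j))))

  -- In a connected graph a vertex v differing from some w has a neighbour: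
  -- the first step of a walk from v to w.
  connected⇒neighbour : Connected G → ∀ {v w} → v ≢ w → ∃ λ u → adj G v u ≡ true
  connected⇒neighbour conn {v} {w} v≢w with conn v w
  ... | here        = contradiction refl v≢w
  ... | step v~u _  = _ , v~u

  adj⇒≢ : ∀ {v w} → adj G v w ≡ true → w ≢ v
  adj⇒≢ {v} v~v refl with trans (≡-sym v~v) (irrefl G v)
  ... | ()

insertAt-zero : ∀ {A : Set} {m} (f : Vector A m) x → insertAt f zero x ≗ x ∷ f
insertAt-zero f x zero    = refl
insertAt-zero f x (suc j) = refl

insertAt-suc : ∀ {A : Set} {m} (f : Vector A (suc m)) t x →
  insertAt f (suc t) x ≗ f zero ∷ insertAt (tail f) t x
insertAt-suc f t x zero    = refl
insertAt-suc f t x (suc j) = refl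

insertAt-avoids : ∀ {A : Set} {m} {x y : A} (f : Vector A m) t → y ≢ x →
  (∀ i → f i ≢ y) → ∀ j → insertAt f t x j ≢ y
insertAt-avoids f zero    y≢x f≢y zero    = y≢x ∘ ≡-sym
insertAt-avoids f zero    y≢x f≢y (suc j) = f≢y j
insertAt-avoids {m = suc m} f (suc t) y≢x f≢y zero    = f≢y zero
insertAt-avoids {m = suc m} f (suc t) y≢x f≢y (suc j) = insertAt-avoids (tail f) t y≢x (f≢y ∘ suc) j

insert-path : ∀ {n m} (G : Graph n) q (p : Fin (suc m) → Fin n) t →
  IsPath G (suc m) p → (∀ i → p i ≢ q) → Gap (adj G q ∘ p) t →
  IsPath G (suc (suc m)) (insertAt p t q)
insert-path G q p zero path p≢q q~p₀ =
  IsPath-≗ G (≡-sym ∘ insertAt-zero p q) (∷-path G path p≢q q~p₀)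
insert-path {m = zero} G q p (suc zero) path p≢q q~p₀ =
  IsPath-≗ G (≡-sym ∘ insertAt-suc p zero q)
    (∷-path G (singleton-path G _) (λ { zero → p≢q zero ∘ ≡-sym })
       (trans (Graph.sym G (p zero) q) q~p₀))
insert-path {m = suc m} G q p (suc t) path@(p-inj , p-walk) p≢q gap =
  IsPath-≗ G (≡-sym ∘ insertAt-suc p t q)
    (∷-path G (shorter t gap) (insertAt-avoids (tail p) t (p≢q zero) p₀-fresh)
       (p₀~next t gap))
  where
  p₀-fresh : ∀ i → p (suc i) ≢ p zero
  p₀-fresh i e with p-inj e
  ... | ()

  shorter : ∀ t → Gap (adj G q ∘ p) (suc t) → IsPath G (suc (suc m)) (insertAt (tail p) t q)
  shorter zero    (_ , gap′) = insert-path G q (tail p) zero (tail-path G path) (p≢q ∘ suc) gap′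
  shorter (suc t) gap′       = insert-path G q (tail p) (suc t) (tail-path G path) (p≢q ∘ suc) gap′

  p₀~next : ∀ t → Gap (adj G q ∘ p) (suc t) → adj G (p zero) (insertAt (tail p) t q zero) ≡ true
  p₀~next zero    (q~p₀ , _) = trans (Graph.sym G (p zero) q) q~p₀
  p₀~next (suc t) _          = p-walk zero (suc zero) refl

≡⇒∈⁅⁆ : ∀ {n} {v u : Fin n} → v ≡ u → v ∈ ⁅ u ⁆
≡⇒∈⁅⁆ refl = x∈⁅x⁆ _

-- If q has exactly one neighbour u, then {u} meets every path on n - 1
-- vertices: a path through q continues to a neighbour of q, and a path
-- avoiding q visits all the other vertices.
pendant-cover : ∀ {m} (G : Graph (suc (suc (suc m)))) q u →
  adj G q u ≡ true → (∀ w → adj G q w ≡ true → w ≡ u) →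
  IsKPathVertexCover G (suc (suc m)) ⁅ u ⁆
pendant-cover G q u q~u only-u f path with any? (λ j → f j ≟ᶠ q)
... | yes (j , fⱼ≡q) with path-neighbour G path j
...   | j′ , fⱼ~fⱼ′ = j′ , ≡⇒∈⁅⁆ (only-u (f j′) (subst (λ v → adj G v (f j′) ≡ true) fⱼ≡q fⱼ~fⱼ′))
pendant-cover G q u q~u only-u f path | no misses-q
  with injective⇒surjective (q ∷ f) (∷-injective (proj₁ path) (λ i e → misses-q (i , e))) u
... | zero  , q≡u  = contradiction (≡-sym q≡u) (adj⇒≢ G q~u)
... | suc i , fᵢ≡u = i , ≡⇒∈⁅⁆ fᵢ≡u

unique-neighbour : ∀ {n} (G : Graph n) v u → adj G v u ≡ true → ¬ 2 ≤ degree G v →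
  ∀ w → adj G v w ≡ true → w ≡ u
unique-neighbour G v u v~u deg<2 w v~w with w ≟ᶠ u
... | yes w≡u = w≡u
... | no  w≢u = contradiction
        (subst (2 ≤_) (≡-sym (degree≡count G v)) (count-two (adj G v) w u w≢u v~w v~u)) deg<2

mainTheorem11 : (n : ℕ) → 4 ≤ n → (G : Graph n) → Connected G →
    (q : Fin n) → (p : Fin (n ∸ 1) → Fin n) →
    (∀ i → p i ≢ q) → IsPath G (n ∸ 1) p →
    ψ-is (n ∸ 1) G 2 → ψ-is n G 0 →
    2 ≤ degree G q × degree G q ≤ ⌈ (n ∸ 3) /2⌉
mainTheorem11 (suc (suc (suc (suc k)))) (s≤s (s≤s (s≤s (s≤s _)))) G conn q p p≢q path ψₙ₋₁≡2 ψₙ≡0 = lower , upper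
  where
  -- q can be inserted nowhere into p, so its neighbours along p leave no gap.
  upper : degree G q ≤ ⌊ suc (suc k) /2⌋
  upper = begin
    degree G q           ≡⟨ degree-along G q p (proj₁ path) p≢q ⟩
    count (adj G q ∘ p)  ≤⟨ gapFree-count (adj G q ∘ p)
                              (λ t gap → ψ≡0⇒noPath G ψₙ≡0 _ (insert-path G q p t path p≢q gap)) ⟩
    ⌊ suc (suc k) /2⌋    ∎
    where open ≤-Reasoning

  -- q has a neighbour u; were it the only one, {u} would be a cover of size one.
  neighbour : ∃ λ u → adj G q u ≡ true
  neighbour = connected⇒neighbour G conn (p≢q zero ∘ ≡-sym)

  lower : 2 ≤ degree G q
  lower with 2 ≤? degree G q
  ... | yes deg≥2 = deg≥2
  ... | no  deg<2 = contradiction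
          (proj₂ ψₙ₋₁≡2 ⁅ u ⁆ (pendant-cover G q u q~u (unique-neighbour G q u q~u deg<2)))
          (λ 2≤∣⁅u⁆∣ → 1+n≰n (≤-trans 2≤∣⁅u⁆∣ (≤-reflexive (∣⁅x⁆∣≡1 u))))
    where
    u : Fin (suc (suc (suc (suc k))))
    u = proj₁ neighbour

    q~u : adj G q u ≡ true
    q~u = proj₂ neighbour
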